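{- Let $n\ge 3$, $k\ge 2$, and let $\mathcal{H}=(V,\mathcal{E})$ be a $k$-uniform hypergraph with $EI(\mathcal{H})=C_n$. Then $|\mathcal{E}|\ge \frac{3n}{k}$; consequently $\mu^k_n\ge\frac{3n}{k}$ (whenever such a hypergraph exists).
   Context: Hypergraphs $\mathcal{H}=(V,\mathcal{E})$ have no multiple hyperedges; isolated vertices are allowed. $\mathcal{H}$ is $k$-uniform if every hyperedge has exactly $k$ elements. The edge intersection hypergraph of $\mathcal{H}$ is $EI(\mathcal{H})=(V,\mathcal{E}^{EI})$ with $\mathcal{E}^{EI}=\{e_1\cap e_2: e_1,e_2\in\mathcal{E},\ e_1\ne e_2,\ |e_1\cap e_2|\ge 2\}$. $C_n$ is the cycle with vertex set $\{1,\dots,n\}$ and edges $\{i,i+1\}$, $i=1,\dots,n$ (indices mod $n$); "$EI(\mathcal{H})=C_n$" means $V=\{1,\dots,n\}$ and $\mathcal{E}^{EI}$ is exactly the edge set of $C_n$. $\mu^k_n$ is the minimum of $|\mathcal{E}|$ over all $k$-uniform $\mathcal{H}=(V,\mathcal{E})$ with $EI(\mathcal{H})=C_n$. -}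

module Defs where

open import Data.Nat using (ℕ; zero; suc; _≤_; _*_)
open import Data.Nat.DivMod using (_mod_)
open import Data.Fin using (Fin; toℕ)
open import Data.Fin.Subset using (Subset; _∩_; _∪_; ⁅_⁆; ∣_∣)
open import Data.List using (List; length)
open import Data.List.Membership.Propositional using (_∈_)
open import Data.List.Relation.Unary.All using (All)
open import Data.List.Relation.Unary.Unique.Propositional using (Unique)
open import Data.Product using (Σ; _×_; ∃-syntax)
open import Relation.Binary.PropositionalEquality using (_≡_; _≢_)

-- A hypergraph on vertex set V = Fin n (standing for {1,…,n}):
-- a duplicate-free list of hyperedges, each a subset of Fin n.
record Hypergraph (n : ℕ) : Set where
  field
    edges  : List (Subset n)
    unique : Unique edges

open Hypergraph public

numEdges : ∀ {n} → Hypergraph n → ℕ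
numEdges H = length (edges H)

Uniform : ∀ {n} → ℕ → Hypergraph n → Set
Uniform k H = All (λ e → ∣ e ∣ ≡ k) (edges H)

EIEdge : ∀ {n} → Hypergraph n → Subset n → Set
EIEdge H s = ∃[ e₁ ] ∃[ e₂ ]
  (e₁ ∈ edges H × e₂ ∈ edges H × e₁ ≢ e₂ × s ≡ e₁ ∩ e₂ × 2 ≤ ∣ s ∣)

nextC : ∀ {n} → Fin n → Fin n
nextC {suc m} i = suc (toℕ i) mod suc m

CycleEdge : ∀ {n} → Subset n → Set
CycleEdge {n} s = Σ (Fin n) λ i → s ≡ ⁅ i ⁆ ∪ ⁅ nextC i ⁆

EIisCycle : ∀ {n} → Hypergraph n → Set
EIisCycle {n} H = (s : Subset n) → (EIEdge H s → CycleEdge s) × (CycleEdge s → EIEdge H s)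

-- A vertex i of C_n lies on the two cycle edges {i-1,i} and {i,i+1}. Each is
-- the intersection of two distinct hyperedges, and since the two intersections
-- differ, the two pairs of hyperedges cannot coincide: i lies in at least three
-- hyperedges. Counting vertex–hyperedge incidences by vertices and by
-- hyperedges then gives 3n ≤ ∑ deg(i) = k|ℰ|.
module Submission where

open import Defs
open import Algebra.Definitions using (Commutative)
open import Data.Bool.Base using (true; false; if_then_else_)
open import Data.Bool.Properties using () renaming (_≟_ to _≟ᵇ_)
open import Data.Fin.Base using (Fin; zero; suc; toℕ; fromℕ; inject₁)
open import Data.Fin.Properties using (toℕ-fromℕ<; toℕ-fromℕ; toℕ-inject₁; toℕ-injective; toℕ<n; injective⇒≤)
open import Data.Fin.Subset using (Subset; _∩_; _∪_; ⁅_⁆; ∣_∣; inside; outside) renaming (_∈_ to _∈ₛ_)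
open import Data.Fin.Subset.Properties using (_∈?_; x∈⁅x⁆; x∈⁅y⁆⇒x≡y; ∩-comm; x∈p∩q⁻; x∈p∪q⁻; x∈p∪q⁺)
open import Data.List.Base using (List; []; _∷_; length; lookup; filter)
open import Data.List.Membership.Propositional using (_∈_)
open import Data.List.Membership.Propositional.Properties using (∈-lookup; ∈-filter⁺)
open import Data.List.Relation.Binary.Subset.Propositional using (_⊆_)
open import Data.List.Relation.Unary.All as All using (All; []; _∷_)
open import Data.List.Relation.Unary.Any using (here; there; index)
open import Data.List.Relation.Unary.Any.Properties using (lookup-index)
open import Data.List.Relation.Unary.Unique.Propositional using (Unique; []; _∷_)
open import Data.Nat.Base using (ℕ; zero; suc; _+_; _*_; _≤_; _<_; s≤s; _%_)
open import Data.Nat.DivMod using (m<n⇒m%n≡m; n%n≡0)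
open import Data.Nat.Properties
open import Data.Product using (∃-syntax; _×_; _,_; proj₁; proj₂)
open import Data.Sum using (_⊎_; inj₁; inj₂)
open import Data.Vec.Base using ([]; _∷_)
open import Data.Vec.Properties using (≡-dec)
open import Function.Base using (_∘_)
open import Function.Definitions using (Injective)
open import Level using (Level)
open import Relation.Binary.Definitions using (DecidableEquality)
open import Relation.Binary.PropositionalEquality
open import Relation.Nullary using (Dec; does; yes; no; contradiction)
open import Algebra.Properties.CommutativeMonoid.Sum +-0-commutativeMonoid
  using (sum-syntax; ∑-distrib-+; sum-cong-≗; sum-replicate-zero)

private
  variable
    a : Level
    A : Set a
    n : ℕ

Unique⇒lookup-injective : {xs : List A} → Unique xs → Injective _≡_ _≡_ (lookup xs)
Unique⇒lookup-injective (_ ∷ _)  {zero}  {zero}  _  = refl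
Unique⇒lookup-injective (x≢ ∷ _) {zero}  {suc j} eq = contradiction eq (All.lookup x≢ (∈-lookup j))
Unique⇒lookup-injective (x≢ ∷ _) {suc i} {zero}  eq = contradiction (sym eq) (All.lookup x≢ (∈-lookup i))
Unique⇒lookup-injective (_ ∷ u)  {suc i} {suc j} eq = cong suc (Unique⇒lookup-injective u eq)

Unique-⊆⇒length≤ : {xs ys : List A} → Unique xs → xs ⊆ ys → length xs ≤ length ys
Unique-⊆⇒length≤ {xs = xs} {ys} u xs⊆ys = injective⇒≤ position-injective
  where
  position : Fin (length xs) → Fin (length ys)
  position i = index (xs⊆ys (∈-lookup i))

  position-injective : Injective _≡_ _≡_ position
  position-injective {i} {j} eq = Unique⇒lookup-injective u (begin
    lookup xs i                ≡⟨ lookup-index (xs⊆ys (∈-lookup i)) ⟩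
    lookup ys (position i)     ≡⟨ cong (lookup ys) eq ⟩
    lookup ys (position j)     ≡⟨ lookup-index (xs⊆ys (∈-lookup j)) ⟨
    lookup xs j                ∎)
    where open ≡-Reasoning

∙-≢⇒outside-pair : {_∙_ : A → A → A} → Commutative _≡_ _∙_ → DecidableEquality A →
  ∀ {a b c d} → a ∙ b ≢ c ∙ d → c ≢ d →
  ∃[ e ] (e ≡ c ⊎ e ≡ d) × e ≢ a × e ≢ b
∙-≢⇒outside-pair {_∙_ = _∙_} comm _≟_ {a} {b} {c} {d} ab≢cd c≢d with c ≟ a | c ≟ b
... | no c≢a | no c≢b = c , inj₁ refl , c≢a , c≢b
... | yes c≡a | _ with d ≟ a | d ≟ b
...   | no d≢a  | no d≢b  = d , inj₂ refl , d≢a , d≢b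
...   | yes d≡a | _       = contradiction (trans c≡a (sym d≡a)) c≢d
...   | no _    | yes d≡b = contradiction (cong₂ _∙_ (sym c≡a) (sym d≡b)) ab≢cd
∙-≢⇒outside-pair {_∙_ = _∙_} comm _≟_ {a} {b} {c} {d} ab≢cd c≢d | no _ | yes c≡b with d ≟ a | d ≟ b
...   | no d≢a  | no d≢b  = d , inj₂ refl , d≢a , d≢b
...   | _       | yes d≡b = contradiction (trans c≡b (sym d≡b)) c≢d
...   | yes d≡a | no _    = contradiction (trans (comm a b) (cong₂ _∙_ (sym c≡b) (sym d≡a))) ab≢cd

toℕ-nextC : (i : Fin (suc n)) →
  (toℕ i < n × toℕ (nextC i) ≡ suc (toℕ i)) ⊎ (toℕ i ≡ n × toℕ (nextC i) ≡ 0)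
toℕ-nextC {n} i with m≤n⇒m<n∨m≡n (≤-pred (toℕ<n i))
... | inj₁ i<n = inj₁ (i<n , trans (toℕ-fromℕ< _) (m<n⇒m%n≡m (s≤s i<n)))
... | inj₂ i≡n = inj₂ (i≡n , trans (toℕ-fromℕ< _) (trans (cong (λ t → suc t % suc n) i≡n) (n%n≡0 (suc n))))

nextC-surjective : (i : Fin (suc n)) → ∃[ j ] nextC j ≡ i
nextC-surjective {n} zero with toℕ-nextC (fromℕ n)
... | inj₁ (n<n , _) = contradiction (toℕ-fromℕ n) (<⇒≢ n<n)
... | inj₂ (_ , p)   = fromℕ n , toℕ-injective p
nextC-surjective (suc i) with toℕ-nextC (inject₁ i)
... | inj₁ (_ , p)   = inject₁ i , toℕ-injective (trans p (cong suc (toℕ-inject₁ i)))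
... | inj₂ (i≡n , _) = contradiction (trans (sym (toℕ-inject₁ i)) i≡n) (<⇒≢ (toℕ<n i))

nextC-irreflexive : (i : Fin (2 + n)) → nextC i ≢ i
nextC-irreflexive i eq with toℕ-nextC i
... | inj₁ (_ , p)   = 1+n≢n (trans (sym p) (cong toℕ eq))
... | inj₂ (i≡n , p) = 0≢1+n (trans (sym p) (trans (cong toℕ eq) i≡n))

nextC²-irreflexive : (i : Fin (3 + n)) → nextC (nextC i) ≢ i
nextC²-irreflexive i eq with toℕ-nextC i | toℕ-nextC (nextC i)
... | inj₁ (_ , p) | inj₁ (_ , q) = m≢1+n+m (toℕ i) (trans (sym (cong toℕ eq)) (trans q (cong suc p)))
... | inj₁ (_ , p) | inj₂ (j≡n , q) =
  0≢1+n (suc-injective (trans (cong suc (trans (sym q) (cong toℕ eq))) (trans (sym p) j≡n)))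
... | inj₂ (i≡n , p) | inj₁ (_ , q) =
  0≢1+n (suc-injective (trans (sym (trans (sym (cong toℕ eq)) (trans q (cong suc p)))) i≡n))
... | inj₂ (_ , p) | inj₂ (j≡n , _) = 0≢1+n (trans (sym p) j≡n)

cycleEdge : Fin n → Subset n
cycleEdge i = ⁅ i ⁆ ∪ ⁅ nextC i ⁆

cycleEdge-nextC-distinct : (i : Fin (3 + n)) → cycleEdge i ≢ cycleEdge (nextC i)
cycleEdge-nextC-distinct i eq
  with x∈p∪q⁻ ⁅ nextC i ⁆ ⁅ nextC (nextC i) ⁆ (subst (i ∈ₛ_) eq (x∈p∪q⁺ (inj₁ (x∈⁅x⁆ i))))
... | inj₁ i∈ = nextC-irreflexive i (sym (x∈⁅y⁆⇒x≡y _ i∈))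
... | inj₂ i∈ = nextC²-irreflexive i (sym (x∈⁅y⁆⇒x≡y _ i∈))

indicator : {P : Set} → Dec P → ℕ
indicator P? = if does P? then 1 else 0

degree : Fin n → List (Subset n) → ℕ
degree i = length ∘ filter (i ∈?_)

degree-∷ : (i : Fin n) (e : Subset n) (es : List (Subset n)) →
  degree i (e ∷ es) ≡ indicator (i ∈? e) + degree i es
degree-∷ i e es with does (i ∈? e)
... | true  = refl
... | false = refl

∣p∣≡∑indicator : (p : Subset n) → ∣ p ∣ ≡ ∑[ i < n ] indicator (i ∈? p)
∣p∣≡∑indicator []            = refl
∣p∣≡∑indicator (inside  ∷ p) = cong suc (∣p∣≡∑indicator p)
∣p∣≡∑indicator (outside ∷ p) = ∣p∣≡∑indicator p

∑-degree-uniform : ∀ {k} {es : List (Subset n)} → All (λ e → ∣ e ∣ ≡ k) es →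
  ∑[ i < n ] degree i es ≡ k * length es
∑-degree-uniform {n} {k} [] = trans (sum-replicate-zero n) (sym (*-zeroʳ k))
∑-degree-uniform {n} {k} {e ∷ es} (∣e∣≡k ∷ uniform) = begin
  ∑[ i < n ] degree i (e ∷ es)
    ≡⟨ sum-cong-≗ (λ i → degree-∷ i e es) ⟩
  ∑[ i < n ] (indicator (i ∈? e) + degree i es)
    ≡⟨ ∑-distrib-+ (λ i → indicator (i ∈? e)) (λ i → degree i es) ⟩
  ∑[ i < n ] indicator (i ∈? e) + ∑[ i < n ] degree i es
    ≡⟨ cong₂ _+_ (trans (sym (∣p∣≡∑indicator e)) ∣e∣≡k) (∑-degree-uniform uniform) ⟩
  k + k * length es
    ≡⟨ *-suc k (length es) ⟨
  k * length (e ∷ es)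
    ∎
  where open ≡-Reasoning

*≤∑ : ∀ {m} n (f : Fin n → ℕ) → (∀ i → m ≤ f i) → m * n ≤ ∑[ i < n ] f i
*≤∑ {m} zero    f m≤f = ≤-reflexive (*-zeroʳ m)
*≤∑ {m} (suc n) f m≤f = begin
  m * suc n                        ≡⟨ *-suc m n ⟩
  m + m * n                        ≤⟨ +-mono-≤ (m≤f zero) (*≤∑ n (f ∘ suc) (m≤f ∘ suc)) ⟩
  f zero + ∑[ i < n ] f (suc i)    ∎
  where open ≤-Reasoning

_≟ₛ_ : DecidableEquality (Subset n)
_≟ₛ_ = ≡-dec _≟ᵇ_

EIEdge-distinct⇒3≤degree : (H : Hypergraph n) {s t : Subset n} {i : Fin n} →
  EIEdge H s → EIEdge H t → s ≢ t → i ∈ₛ s → i ∈ₛ t → 3 ≤ degree i (edges H)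
EIEdge-distinct⇒3≤degree H {i = i}
  (a , b , a∈H , b∈H , a≢b , s≡a∩b , _) (c , d , c∈H , d∈H , c≢d , t≡c∩d , _) s≢t i∈s i∈t
  with ∙-≢⇒outside-pair ∩-comm _≟ₛ_ (λ eq → s≢t (trans s≡a∩b (trans eq (sym t≡c∩d)))) c≢d
... | e , e∈cd , e≢a , e≢b = Unique-⊆⇒length≤ abe-unique abe⊆incident
  where
  i∈a×b : i ∈ₛ a × i ∈ₛ b
  i∈a×b = x∈p∩q⁻ a b (subst (i ∈ₛ_) s≡a∩b i∈s)
  i∈c×d : i ∈ₛ c × i ∈ₛ d
  i∈c×d = x∈p∩q⁻ c d (subst (i ∈ₛ_) t≡c∩d i∈t)

  incident : ∀ {x} → x ≡ c ⊎ x ≡ d → x ∈ edges H × i ∈ₛ x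
  incident (inj₁ refl) = c∈H , proj₁ i∈c×d
  incident (inj₂ refl) = d∈H , proj₂ i∈c×d

  abe-unique : Unique (a ∷ b ∷ e ∷ [])
  abe-unique = (a≢b ∷ (e≢a ∘ sym) ∷ []) ∷ ((e≢b ∘ sym) ∷ []) ∷ [] ∷ []

  abe⊆incident : a ∷ b ∷ e ∷ [] ⊆ filter (i ∈?_) (edges H)
  abe⊆incident (here refl)                 = ∈-filter⁺ (i ∈?_) a∈H (proj₁ i∈a×b)
  abe⊆incident (there (here refl))         = ∈-filter⁺ (i ∈?_) b∈H (proj₂ i∈a×b)
  abe⊆incident (there (there (here refl))) = ∈-filter⁺ (i ∈?_) (proj₁ (incident e∈cd)) (proj₂ (incident e∈cd))

EIisCycle⇒3≤degree : (H : Hypergraph (3 + n)) → EIisCycle H → ∀ i → 3 ≤ degree i (edges H)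
EIisCycle⇒3≤degree H cycle i with nextC-surjective i
... | j , refl = EIEdge-distinct⇒3≤degree H (EIEdge-at j) (EIEdge-at (nextC j))
  (cycleEdge-nextC-distinct j) (x∈p∪q⁺ (inj₂ (x∈⁅x⁆ (nextC j)))) (x∈p∪q⁺ (inj₁ (x∈⁅x⁆ (nextC j))))
  where
  EIEdge-at : ∀ k → EIEdge H (cycleEdge k)
  EIEdge-at k = proj₂ (cycle (cycleEdge k)) (k , refl)

corollary1 : (n k : ℕ) → 3 ≤ n → 2 ≤ k → (H : Hypergraph n) →
    Uniform k H → EIisCycle H → 3 * n ≤ k * numEdges H
corollary1 n@(suc (suc (suc _))) k (s≤s (s≤s (s≤s _))) _ H uniform cycle = begin
  3 * n                          ≤⟨ *≤∑ n (λ i → degree i (edges H)) (EIisCycle⇒3≤degree H cycle) ⟩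
  ∑[ i < n ] degree i (edges H)  ≡⟨ ∑-degree-uniform uniform ⟩
  k * numEdges H                 ∎
  where open ≤-Reasoning
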